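{- In $\mathtt{IK}_\omega$, for any multisets $\Gamma,\Delta$ and any literal $P$, the atomic cut rule "from $\vdash\Gamma,P$ and $\vdash\Delta,\overline{P}$ infer $\vdash\Gamma,\Delta$" is admissible.
   Context: $\mathtt{IK}_\omega$ is the truth-free infinitary multiplicative system: a one-sided sequent calculus whose sequents consist of (possibly countably infinite) multisets of formulas built from literals $P,\overline{P}$ with $\otimes$ (multiplicative conjunction), $⅋$ (multiplicative disjunction, "par"), $\forall$ and $\exists$; $t_1,t_2,\ldots$ enumerates all terms. Rules: initial sequents $\vdash\Gamma,P,\overline{P}$; from $\vdash\Gamma,A,B$ infer $\vdash\Gamma,A⅋B$; from $\vdash\Gamma,A$ and $\vdash\Delta,B$ infer $\vdash\Gamma,\Delta,A\otimes B$; from $\vdash\Gamma_i,A(t_i/x)$ for every $i\in I$ infer $\vdash\biguplus_{i\in I}\Gamma_i,\forall xA$; from $\vdash\Gamma,A(t_1/x),A(t_2/x),\ldots$ infer $\vdash\Gamma,\exists xA$. Derivations are well-founded trees with ordinal heights. Weakening is admissible. -}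

module Defs where

open import Data.Nat using (ℕ; _≟_)
open import Data.List using (List; []; _∷_)
open import Data.Product using (Σ; _,_)
open import Data.Sum using (_⊎_; inj₁; inj₂)
open import Data.Unit using (⊤; tt)
open import Relation.Nullary using (yes; no)
open import Relation.Binary.PropositionalEquality using (_≡_)
open import Function.Bundles using (_↔_; Inverse)
open import Function.Definitions using (Injective)

data Term : Set where
  var : ℕ → Term
  fn  : ℕ → List Term → Term

-- closed terms: the range of the enumeration t₁, t₂, …
data CTerm : Set where
  cfn : ℕ → List CTerm → CTerm

mutual
  embed : CTerm → Term
  embed (cfn f ts) = fn f (embeds ts)

  embeds : List CTerm → List Term
  embeds []       = []
  embeds (t ∷ ts) = embed t ∷ embeds ts

-- substitution of a closed term for a variable (no capture possible)
mutual
  substT : CTerm → ℕ → Term → Term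
  substT t x (var y) with x ≟ y
  ... | yes _ = embed t
  ... | no  _ = var y
  substT t x (fn f us) = fn f (substTs t x us)

  substTs : CTerm → ℕ → List Term → List Term
  substTs t x []       = []
  substTs t x (u ∷ us) = substT t x u ∷ substTs t x us

record Atom : Set where
  constructor atom
  field
    pred : ℕ
    args : List Term

data Literal : Set where
  pos : Atom → Literal
  neg : Atom → Literal

comp : Literal → Literal
comp (pos a) = neg a
comp (neg a) = pos a

substA : CTerm → ℕ → Atom → Atom
substA t x (atom p us) = atom p (substTs t x us)

substL : CTerm → ℕ → Literal → Literal
substL t x (pos a) = pos (substA t x a)
substL t x (neg a) = neg (substA t x a)

infixr 6 _⊗_ _⅋_
data Formula : Set where
  lit  : Literal → Formula
  _⊗_  : Formula → Formula → Formula
  _⅋_  : Formula → Formula → Formula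
  all  : ℕ → Formula → Formula
  ex   : ℕ → Formula → Formula

subst : CTerm → ℕ → Formula → Formula
subst t x (lit l)  = lit (substL t x l)
subst t x (A ⊗ B)  = subst t x A ⊗ subst t x B
subst t x (A ⅋ B)  = subst t x A ⅋ subst t x B
subst t x (all y A) with x ≟ y
... | yes _ = all y A
... | no  _ = all y (subst t x A)
subst t x (ex y A) with x ≟ y
... | yes _ = ex y A
... | no  _ = ex y (subst t x A)

-- Sequents: multisets of formulas, represented as families indexed by
-- an arbitrary type, taken up to re-indexing bijections (see _≅_).

record Seq : Set₁ where
  constructor mkSeq
  field
    Idx : Set
    fm  : Idx → Formula
open Seq public

Countable : Seq → Set
Countable Γ = Σ (Idx Γ → ℕ) λ f → Injective _≡_ _≡_ f

_≅_ : Seq → Seq → Set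
Γ ≅ Δ = Σ (Idx Γ ↔ Idx Δ) λ e → ∀ i → fm Δ (Inverse.to e i) ≡ fm Γ i

infixl 5 _,,_ _∪_

_,,_ : Seq → Formula → Seq
Γ ,, A = mkSeq (Idx Γ ⊎ ⊤) λ { (inj₁ i) → fm Γ i ; (inj₂ _) → A }

_∪_ : Seq → Seq → Seq
Γ ∪ Δ = mkSeq (Idx Γ ⊎ Idx Δ) λ { (inj₁ i) → fm Γ i ; (inj₂ j) → fm Δ j }

⨄ : (CTerm → Seq) → Seq
⨄ Γs = mkSeq (Σ CTerm λ t → Idx (Γs t)) λ { (t , i) → fm (Γs t) i }

_,,inst_∙_ : Seq → ℕ → Formula → Seq
Γ ,,inst x ∙ A = mkSeq (Idx Γ ⊎ CTerm) λ { (inj₁ i) → fm Γ i ; (inj₂ t) → subst t x A }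

infix 2 ⊢_
data ⊢_ : Seq → Set₁ where
  init   : ∀ Γ (P : Literal) → ⊢ Γ ,, lit P ,, lit (comp P)
  par    : ∀ {Γ A B} → ⊢ Γ ,, A ,, B → ⊢ Γ ,, (A ⅋ B)
  tensor : ∀ {Γ Δ A B} → ⊢ Γ ,, A → ⊢ Δ ,, B → ⊢ Γ ∪ Δ ,, (A ⊗ B)
  allR   : ∀ {x A} (Γs : CTerm → Seq) →
           (∀ t → ⊢ Γs t ,, subst t x A) → ⊢ ⨄ Γs ,, all x A
  exR    : ∀ {Γ x A} → ⊢ Γ ,,inst x ∙ A → ⊢ Γ ,, ex x A
  -- sequents are multisets: derivability is invariant under multiset equality
  reindex : ∀ {Γ Δ} → Γ ≅ Δ → ⊢ Γ → ⊢ Δ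

-- By induction on the derivation of ⊢ Γ, P, keeping track of the occurrence of P.
-- A literal is never the principal formula of a logical rule, so every logical rule
-- commutes with the cut: for ∀ the cut is pushed into the single premise whose side
-- context contains P, and Δ is added to that premise only.  In an initial sequent either
-- P is a side formula, and the sequent stays initial, or P is principal, and the
-- conclusion is a weakening of ⊢ Δ, P̄.  Removing an occurrence from a multiset needs
-- decidable equality of occurrences; this is all countability of Γ is used for.
module Submission where

open import Defs
open import Data.Bool.Properties using (T-irrelevant)
open import Data.List using (List; []; _∷_)
open import Data.List.Properties using (∷-dec)
open import Data.Nat using (ℕ)
import Data.Nat as ℕ
open import Data.Product using (Σ; _,_; proj₁; proj₂; _×_; uncurry)
open import Data.Sum using (_⊎_; inj₁; inj₂) renaming (map to ⊎-map)
open import Data.Sum.Properties using (inj₁-injective; inj₂-injective) renaming (≡-dec to ⊎-≡-dec)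
open import Data.Unit using (⊤; tt)
import Data.Unit.Properties as ⊤
open import Data.Empty using (⊥-elim)
open import Function using (_∘_)
open import Function.Bundles using (Inverse; mk↔ₛ′)
open import Relation.Binary.Definitions using (DecidableEquality)
open import Relation.Binary.PropositionalEquality using (_≡_; _≢_; refl; sym; trans; cong; cong₂)
open import Relation.Nullary using (yes; no; Dec)
open import Relation.Nullary.Decidable using (False; map′; fromWitnessFalse; toWitnessFalse; _×-dec_)

private
  variable
    S S′ T T′ U D Θ : Seq
    A : Formula
    x : ℕ

infix 2 _≃_
record _≃_ (S T : Seq) : Set where
  field
    to       : Idx S → Idx T
    from     : Idx T → Idx S
    to-from  : ∀ j → to (from j) ≡ j
    from-to  : ∀ i → from (to i) ≡ i
    fm-to    : ∀ i → fm T (to i) ≡ fm S i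
open _≃_

≅⇒≃ : S ≅ T → S ≃ T
≅⇒≃ (e , fm-to) = record
  { to = Inverse.to e ; from = Inverse.from e
  ; to-from = Inverse.strictlyInverseˡ e ; from-to = Inverse.strictlyInverseʳ e ; fm-to = fm-to }

⊢-resp-≃ : S ≃ T → ⊢ S → ⊢ T
⊢-resp-≃ e = reindex (mk↔ₛ′ (to e) (from e) (to-from e) (from-to e) , fm-to e)

≃-refl : S ≃ S
≃-refl = record
  { to = λ i → i ; from = λ i → i ; to-from = λ _ → refl ; from-to = λ _ → refl ; fm-to = λ _ → refl }

≃-sym : S ≃ T → T ≃ S
≃-sym {T = T} e = record
  { to = from e ; from = to e ; to-from = from-to e ; from-to = to-from e
  ; fm-to = λ j → trans (sym (fm-to e (from e j))) (cong (fm T) (to-from e j)) }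

infixr 4 _⊚_
_⊚_ : S ≃ T → T ≃ U → S ≃ U
e ⊚ f = record
  { to = to f ∘ to e ; from = from e ∘ from f
  ; to-from = λ k → trans (cong (to f) (to-from e (from f k))) (to-from f k)
  ; from-to = λ i → trans (cong (from e) (from-to f (to e i))) (from-to e i)
  ; fm-to = λ i → trans (fm-to f (to e i)) (fm-to e i) }

to-injective : (e : S ≃ T) {i i′ : Idx S} → to e i ≡ to e i′ → i ≡ i′
to-injective e {i} {i′} p = trans (sym (from-to e i)) (trans (cong (from e) p) (from-to e i′))

from-injective : (e : S ≃ T) {j j′ : Idx T} → from e j ≡ from e j′ → j ≡ j′
from-injective e = to-injective (≃-sym e)

⟨_⟩ : Formula → Seq
⟨ A ⟩ = mkSeq ⊤ (λ _ → A)

instances : ℕ → Formula → Seq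
instances x A = mkSeq CTerm (λ t → subst t x A)

,,-as-∪ : S ,, A ≃ S ∪ ⟨ A ⟩
,,-as-∪ = record
  { to = λ i → i ; from = λ i → i ; to-from = λ _ → refl ; from-to = λ _ → refl
  ; fm-to = λ { (inj₁ _) → refl ; (inj₂ _) → refl } }

inst-as-∪ : S ,,inst x ∙ A ≃ S ∪ instances x A
inst-as-∪ = record
  { to = λ i → i ; from = λ i → i ; to-from = λ _ → refl ; from-to = λ _ → refl
  ; fm-to = λ { (inj₁ _) → refl ; (inj₂ _) → refl } }

∪-cong : S ≃ S′ → T ≃ T′ → S ∪ T ≃ S′ ∪ T′
∪-cong e f = record
  { to = ⊎-map (to e) (to f) ; from = ⊎-map (from e) (from f)
  ; to-from = λ { (inj₁ i) → cong inj₁ (to-from e i) ; (inj₂ j) → cong inj₂ (to-from f j) }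
  ; from-to = λ { (inj₁ i) → cong inj₁ (from-to e i) ; (inj₂ j) → cong inj₂ (from-to f j) }
  ; fm-to = λ { (inj₁ i) → fm-to e i ; (inj₂ j) → fm-to f j } }

,,-cong : S ≃ S′ → S ,, A ≃ S′ ,, A
,,-cong e = ,,-as-∪ ⊚ ∪-cong e ≃-refl ⊚ ≃-sym ,,-as-∪

∪-comm : S ∪ T ≃ T ∪ S
∪-comm = record
  { to = λ { (inj₁ i) → inj₂ i ; (inj₂ j) → inj₁ j }
  ; from = λ { (inj₁ j) → inj₂ j ; (inj₂ i) → inj₁ i }
  ; to-from = λ { (inj₁ _) → refl ; (inj₂ _) → refl }
  ; from-to = λ { (inj₁ _) → refl ; (inj₂ _) → refl }
  ; fm-to = λ { (inj₁ _) → refl ; (inj₂ _) → refl } }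

∪-assoc : (S ∪ T) ∪ U ≃ S ∪ (T ∪ U)
∪-assoc = record
  { to = λ { (inj₁ (inj₁ i)) → inj₁ i ; (inj₁ (inj₂ j)) → inj₂ (inj₁ j) ; (inj₂ k) → inj₂ (inj₂ k) }
  ; from = λ { (inj₁ i) → inj₁ (inj₁ i) ; (inj₂ (inj₁ j)) → inj₁ (inj₂ j) ; (inj₂ (inj₂ k)) → inj₂ k }
  ; to-from = λ { (inj₁ _) → refl ; (inj₂ (inj₁ _)) → refl ; (inj₂ (inj₂ _)) → refl }
  ; from-to = λ { (inj₁ (inj₁ _)) → refl ; (inj₁ (inj₂ _)) → refl ; (inj₂ _) → refl }
  ; fm-to = λ { (inj₁ (inj₁ _)) → refl ; (inj₁ (inj₂ _)) → refl ; (inj₂ _) → refl } }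

∪-swapʳ : (S ∪ T) ∪ U ≃ (S ∪ U) ∪ T
∪-swapʳ = ∪-assoc ⊚ ∪-cong ≃-refl ∪-comm ⊚ ≃-sym ∪-assoc

,,-∪-comm : (S ,, A) ∪ D ≃ (S ∪ D) ,, A
,,-∪-comm = ∪-cong ,,-as-∪ ≃-refl ⊚ ∪-swapʳ ⊚ ≃-sym ,,-as-∪

inst-∪-comm : (S ,,inst x ∙ A) ∪ D ≃ (S ∪ D) ,,inst x ∙ A
inst-∪-comm = ∪-cong inst-as-∪ ≃-refl ⊚ ∪-swapʳ ⊚ ≃-sym inst-as-∪

onlyAt : CTerm → Seq → CTerm → Seq
onlyAt t₀ Θ t = mkSeq (t ≡ t₀ × Idx Θ) (fm Θ ∘ proj₂)

onlyAt-here : ∀ {t} → Θ ≃ onlyAt t Θ t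
onlyAt-here = record
  { to = refl ,_ ; from = proj₂ ; to-from = λ { (refl , _) → refl } ; from-to = λ _ → refl
  ; fm-to = λ _ → refl }

∪-onlyAt-elsewhere : ∀ {t u} → u ≢ t → S ≃ S ∪ onlyAt t Θ u
∪-onlyAt-elsewhere u≢t = record
  { to = inj₁ ; from = λ { (inj₁ i) → i ; (inj₂ (u≡t , _)) → ⊥-elim (u≢t u≡t) }
  ; to-from = λ { (inj₁ _) → refl ; (inj₂ (u≡t , _)) → ⊥-elim (u≢t u≡t) }
  ; from-to = λ _ → refl ; fm-to = λ _ → refl }

⨄-∪-onlyAt : ∀ {Γs} t₀ → ⨄ (λ t → Γs t ∪ onlyAt t₀ Θ t) ≃ ⨄ Γs ∪ Θ
⨄-∪-onlyAt t₀ = record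
  { to = λ { (t , inj₁ i) → inj₁ (t , i) ; (t , inj₂ (refl , j)) → inj₂ j }
  ; from = λ { (inj₁ (t , i)) → t , inj₁ i ; (inj₂ j) → t₀ , inj₂ (refl , j) }
  ; to-from = λ { (inj₁ _) → refl ; (inj₂ _) → refl }
  ; from-to = λ { (_ , inj₁ _) → refl ; (_ , inj₂ (refl , _)) → refl }
  ; fm-to = λ { (_ , inj₁ _) → refl ; (_ , inj₂ (refl , _)) → refl } }

weaken : ∀ Θ → ⊢ S → ⊢ S ∪ Θ
weaken Θ (init Γ P) = ⊢-resp-≃ (≃-sym (,,-∪-comm ⊚ ,,-cong ,,-∪-comm)) (init (Γ ∪ Θ) P)
weaken Θ (par d) =
  ⊢-resp-≃ (≃-sym ,,-∪-comm) (par (⊢-resp-≃ (,,-∪-comm ⊚ ,,-cong ,,-∪-comm) (weaken Θ d)))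
weaken Θ (tensor d e) =
  ⊢-resp-≃ (≃-sym (,,-∪-comm ⊚ ,,-cong ∪-swapʳ)) (tensor (⊢-resp-≃ ,,-∪-comm (weaken Θ d)) e)
weaken Θ (allR Γs f) =
  ⊢-resp-≃ (,,-cong (⨄-∪-onlyAt t₀) ⊚ ≃-sym ,,-∪-comm)
    (allR (λ t → Γs t ∪ onlyAt t₀ Θ t) (λ t → ⊢-resp-≃ ,,-∪-comm (weaken (onlyAt t₀ Θ t) (f t))))
  where
    t₀ : CTerm
    t₀ = cfn 0 []
weaken Θ (exR d) = ⊢-resp-≃ (≃-sym ,,-∪-comm) (exR (⊢-resp-≃ inst-∪-comm (weaken Θ d)))
weaken Θ (reindex e d) = ⊢-resp-≃ (∪-cong (≅⇒≃ e) ≃-refl) (weaken Θ d)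

DecIdx : Seq → Set
DecIdx S = DecidableEquality (Idx S)

-- False (j ≟ k) rather than j ≢ k: its proofs are unique without function extensionality.
remove : (S : Seq) → DecIdx S → Idx S → Seq
remove S _≟_ k = mkSeq (Σ (Idx S) λ j → False (j ≟ k)) (fm S ∘ proj₁)

False-map : ∀ {P Q : Set} {P? : Dec P} {Q? : Dec Q} → (Q → P) → False P? → False Q?
False-map f p = fromWitnessFalse (toWitnessFalse p ∘ f)

,-False-≡ : ∀ {I : Set} {P : I → Set} {P? : ∀ i → Dec (P i)} {i i′ : I}
            {p : False (P? i)} {p′ : False (P? i′)} → i ≡ i′ →
            _≡_ {A = Σ I λ j → False (P? j)} (i , p) (i′ , p′)
,-False-≡ refl = cong (_ ,_) (T-irrelevant _ _)

remove-resp-≃ : (e : S ≃ T) (_≟ˢ_ : DecIdx S) (_≟ᵗ_ : DecIdx T) → ∀ k →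
                remove S _≟ˢ_ (from e k) ≃ remove T _≟ᵗ_ k
remove-resp-≃ e _ _ k = record
  { to = λ { (i , p) → to e i , False-map (λ q → trans (sym (from-to e i)) (cong (from e) q)) p }
  ; from = λ { (j , p) → from e j , False-map (from-injective e) p }
  ; to-from = λ { (j , _) → ,-False-≡ (to-from e j) }
  ; from-to = λ { (i , _) → ,-False-≡ (from-to e i) }
  ; fm-to = λ { (i , _) → fm-to e i } }

remove-∪ˡ : (_≟_ : DecIdx (S ∪ U)) (_≟ˢ_ : DecIdx S) → ∀ k →
            remove (S ∪ U) _≟_ (inj₁ k) ≃ remove S _≟ˢ_ k ∪ U
remove-∪ˡ _≟_ _ k = record
  { to = λ { (inj₁ i , p) → inj₁ (i , False-map (cong inj₁) p) ; (inj₂ u , _) → inj₂ u }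
  ; from = λ { (inj₁ (i , p)) → inj₁ i , False-map inj₁-injective p
             ; (inj₂ u) → inj₂ u , fromWitnessFalse (λ ()) }
  ; to-from = λ { (inj₁ _) → cong inj₁ (,-False-≡ refl) ; (inj₂ _) → refl }
  ; from-to = λ { (inj₁ _ , _) → ,-False-≡ refl ; (inj₂ _ , _) → ,-False-≡ refl }
  ; fm-to = λ { (inj₁ _ , _) → refl ; (inj₂ _ , _) → refl } }

remove-∪ʳ : (_≟_ : DecIdx (S ∪ U)) (_≟ᵘ_ : DecIdx U) → ∀ k →
            remove (S ∪ U) _≟_ (inj₂ k) ≃ S ∪ remove U _≟ᵘ_ k
remove-∪ʳ _≟_ _ k = record
  { to = λ { (inj₂ i , p) → inj₂ (i , False-map (cong inj₂) p) ; (inj₁ s , _) → inj₁ s }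
  ; from = λ { (inj₂ (i , p)) → inj₂ i , False-map inj₂-injective p
             ; (inj₁ s) → inj₁ s , fromWitnessFalse (λ ()) }
  ; to-from = λ { (inj₂ _) → cong inj₂ (,-False-≡ refl) ; (inj₁ _) → refl }
  ; from-to = λ { (inj₂ _ , _) → ,-False-≡ refl ; (inj₁ _ , _) → ,-False-≡ refl }
  ; fm-to = λ { (inj₂ _ , _) → refl ; (inj₁ _ , _) → refl } }

remove-top : (_≟_ : DecIdx (S ,, A)) → remove (S ,, A) _≟_ (inj₂ tt) ≃ S
remove-top _≟_ = record
  { to = λ { (inj₁ i , _) → i ; (inj₂ tt , p) → ⊥-elim (toWitnessFalse p refl) }
  ; from = λ i → inj₁ i , fromWitnessFalse (λ ())
  ; to-from = λ _ → refl
  ; from-to = λ { (inj₁ _ , _) → ,-False-≡ refl ; (inj₂ tt , p) → ⊥-elim (toWitnessFalse p refl) }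
  ; fm-to = λ { (inj₁ _ , _) → refl ; (inj₂ tt , p) → ⊥-elim (toWitnessFalse p refl) } }

remove-,, : (_≟_ : DecIdx (S ,, A)) (_≟ˢ_ : DecIdx S) → ∀ k →
            remove (S ,, A) _≟_ (inj₁ k) ≃ remove S _≟ˢ_ k ,, A
remove-,, _≟_ _≟ˢ_ k =
  remove-resp-≃ ,,-as-∪ _≟_ _≟_ (inj₁ k) ⊚ remove-∪ˡ _≟_ _≟ˢ_ k ⊚ ≃-sym ,,-as-∪

remove-inst : (_≟_ : DecIdx (S ,,inst x ∙ A)) (_≟ˢ_ : DecIdx S) → ∀ k →
              remove (S ,,inst x ∙ A) _≟_ (inj₁ k) ≃ remove S _≟ˢ_ k ,,inst x ∙ A
remove-inst _≟_ _≟ˢ_ k =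
  remove-resp-≃ inst-as-∪ _≟_ _≟_ (inj₁ k) ⊚ remove-∪ˡ _≟_ _≟ˢ_ k ⊚ ≃-sym inst-as-∪

remove-,,-∪-comm : (_≟_ : DecIdx (S ,, A)) (_≟ˢ_ : DecIdx S) → ∀ k →
                   remove (S ,, A) _≟_ (inj₁ k) ∪ D ≃ (remove S _≟ˢ_ k ∪ D) ,, A
remove-,,-∪-comm _≟_ _≟ˢ_ k = ∪-cong (remove-,, _≟_ _≟ˢ_ k) ≃-refl ⊚ ,,-∪-comm

module _ (Γs : CTerm → Seq) (_≟_ : DecIdx (⨄ Γs)) (t : CTerm) (i : Idx (Γs t)) where

  removeIn : CTerm → Seq
  removeIn u = mkSeq (Σ (Idx (Γs u)) λ j → False ((u , j) ≟ (t , i))) (fm (Γs u) ∘ proj₁)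

  ⨄-removeIn : ⨄ removeIn ≃ remove (⨄ Γs) _≟_ (t , i)
  ⨄-removeIn = record
    { to = λ { (u , j , p) → (u , j) , p } ; from = λ { ((u , j) , p) → u , j , p }
    ; to-from = λ _ → refl ; from-to = λ _ → refl ; fm-to = λ _ → refl }

  removeIn-here : (_≟ₜ_ : DecIdx (Γs t)) → remove (Γs t) _≟ₜ_ i ≃ removeIn t
  removeIn-here _ = record
    { to = λ { (j , p) → j , False-map (λ { refl → refl }) p }
    ; from = λ { (j , p) → j , False-map (cong (t ,_)) p }
    ; to-from = λ _ → ,-False-≡ refl ; from-to = λ _ → ,-False-≡ refl ; fm-to = λ _ → refl }

  removeIn-elsewhere : ∀ {u} → u ≢ t → Γs u ≃ removeIn u
  removeIn-elsewhere u≢t = record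
    { to = λ j → j , fromWitnessFalse (u≢t ∘ cong proj₁) ; from = proj₁
    ; to-from = λ _ → ,-False-≡ refl ; from-to = λ _ → refl ; fm-to = λ _ → refl }

inj₁-≡-dec : ∀ {I J : Set} → DecidableEquality (I ⊎ J) → DecidableEquality I
inj₁-≡-dec _≟_ i i′ = map′ inj₁-injective (cong inj₁) (inj₁ i ≟ inj₁ i′)

inj₂-≡-dec : ∀ {I J : Set} → DecidableEquality (I ⊎ J) → DecidableEquality J
inj₂-≡-dec _≟_ j j′ = map′ inj₂-injective (cong inj₂) (inj₂ j ≟ inj₂ j′)

fibre-≡-dec : ∀ {I : Set} {J : I → Set} → DecidableEquality (Σ I J) → ∀ i → DecidableEquality (J i)
fibre-≡-dec _≟_ i j j′ = map′ (λ { refl → refl }) (cong (i ,_)) ((i , j) ≟ (i , j′))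

≃-≡-dec : S ≃ T → DecIdx S → DecIdx T
≃-≡-dec e _≟_ j j′ = map′ (from-injective e) (cong (from e)) (from e j ≟ from e j′)

countable⇒≡-dec : ∀ S → Countable S → DecIdx S
countable⇒≡-dec _ (f , f-injective) i i′ = map′ f-injective (cong f) (f i ℕ.≟ f i′)

cfn-injective : ∀ {f g ts us} → cfn f ts ≡ cfn g us → f ≡ g × ts ≡ us
cfn-injective refl = refl , refl

mutual
  _≟ᶜ_ : DecidableEquality CTerm
  cfn f ts ≟ᶜ cfn g us = map′ (uncurry (cong₂ cfn)) cfn-injective (f ℕ.≟ g ×-dec ts ≟ᶜˢ us)

  _≟ᶜˢ_ : DecidableEquality (List CTerm)
  []       ≟ᶜˢ []       = yes refl
  []       ≟ᶜˢ (_ ∷ _)  = no λ ()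
  (_ ∷ _)  ≟ᶜˢ []       = no λ ()
  (t ∷ ts) ≟ᶜˢ (u ∷ us) = ∷-dec (t ≟ᶜ u) (ts ≟ᶜˢ us)

comp-involutive : ∀ Q → comp (comp Q) ≡ Q
comp-involutive (pos _) = refl
comp-involutive (neg _) = refl

lit-injective : ∀ {Q R} → lit Q ≡ lit R → Q ≡ R
lit-injective refl = refl

module AtomicCut (Δ : Seq) (P : Literal) (⊢Δ,P̄ : ⊢ Δ ,, lit (comp P)) where

  cut-axiom : ∀ Γ Q → Q ≡ comp P → ⊢ (Γ ,, lit Q) ∪ Δ
  cut-axiom Γ _ refl = ⊢-resp-≃ (,,-∪-comm ⊚ ,,-cong ∪-comm ⊚ ≃-sym ,,-∪-comm) (weaken Γ ⊢Δ,P̄)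

  cut-init : ∀ Γ Q (_≟_ : DecIdx (Γ ,, lit Q ,, lit (comp Q))) → ∀ k →
             fm (Γ ,, lit Q ,, lit (comp Q)) k ≡ lit P →
             ⊢ remove (Γ ,, lit Q ,, lit (comp Q)) _≟_ k ∪ Δ
  cut-init Γ Q _≟_ (inj₂ tt) Q̄≡P =
    ⊢-resp-≃ (∪-cong (≃-sym (remove-top _≟_)) ≃-refl)
      (cut-axiom Γ Q (trans (sym (comp-involutive Q)) (cong comp (lit-injective Q̄≡P))))
  cut-init Γ Q _≟_ (inj₁ (inj₂ tt)) Q≡P =
    ⊢-resp-≃ (∪-cong (≃-sym (remove-,, _≟_ _≟₁_ (inj₂ tt) ⊚ ,,-cong (remove-top _≟₁_))) ≃-refl)
      (cut-axiom Γ (comp Q) (cong comp (lit-injective Q≡P)))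
    where _≟₁_ = inj₁-≡-dec _≟_
  cut-init Γ Q _≟_ (inj₁ (inj₁ i)) _ =
    ⊢-resp-≃ (≃-sym (remove-,,-∪-comm _≟_ _≟₁_ (inj₁ i) ⊚ ,,-cong (remove-,,-∪-comm _≟₁_ _≟₂_ i)))
      (init _ Q)
    where
      _≟₁_ = inj₁-≡-dec _≟_
      _≟₂_ = inj₁-≡-dec _≟₁_

  cut-allR : ∀ {x A} (Γs : CTerm → Seq) → (∀ u → ⊢ Γs u ,, subst u x A) →
             (_≟_ : DecIdx (⨄ Γs)) (t : CTerm) (i : Idx (Γs t)) →
             ⊢ (remove (Γs t) (fibre-≡-dec _≟_ t) i ∪ Δ) ,, subst t x A →
             ⊢ (remove (⨄ Γs) _≟_ (t , i) ∪ Δ) ,, all x A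
  cut-allR {x} {A} Γs ⊢Γs _≟_ t i ⊢cutₜ =
    ⊢-resp-≃ (,,-cong (⨄-∪-onlyAt t ⊚ ∪-cong (⨄-removeIn Γs _≟_ t i) ≃-refl))
      (allR (λ u → removeIn Γs _≟_ t i u ∪ onlyAt t Δ u) premise)
    where
      premise : ∀ u → ⊢ removeIn Γs _≟_ t i u ∪ onlyAt t Δ u ,, subst u x A
      premise u with u ≟ᶜ t
      ... | no u≢t =
        ⊢-resp-≃ (,,-cong (removeIn-elsewhere Γs _≟_ t i u≢t ⊚ ∪-onlyAt-elsewhere u≢t)) (⊢Γs u)
      ... | yes refl =
        ⊢-resp-≃ (,,-cong (∪-cong (removeIn-here Γs _≟_ t i (fibre-≡-dec _≟_ t)) onlyAt-here)) ⊢cutₜ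

  mutual
    cut : ⊢ S → (_≟_ : DecIdx S) (k : Idx S) → fm S k ≡ lit P → ⊢ remove S _≟_ k ∪ Δ
    cut (init Γ Q) _≟_ k eq = cut-init Γ Q _≟_ k eq
    cut (par _) _ (inj₂ tt) ()
    cut (par d) _≟_ (inj₁ k) eq =
      ⊢-resp-≃ (≃-sym (remove-,,-∪-comm _≟_ _≟ᵍ_ k))
        (par (⊢-resp-≃ (,,-cong (remove-,,-∪-comm _≟ᵃ_ _≟ᵍ_ k)) (cut-beside d _≟ᵃ_ (inj₁ k) eq)))
      where
        _≟ᵍ_ = inj₁-≡-dec _≟_
        _≟ᵃ_ = ⊎-≡-dec _≟ᵍ_ ⊤._≟_
    cut (tensor _ _) _ (inj₂ tt) ()
    cut (tensor d e) _≟_ (inj₁ (inj₁ k)) eq =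
      ⊢-resp-≃ (≃-sym (remove-,,-∪-comm _≟_ _≟ᵘ_ (inj₁ k)
                        ⊚ ,,-cong (∪-cong (remove-∪ˡ _≟ᵘ_ _≟ˡ_ k) ≃-refl ⊚ ∪-swapʳ)))
        (tensor (cut-beside d _≟ˡ_ k eq) e)
      where
        _≟ᵘ_ = inj₁-≡-dec _≟_
        _≟ˡ_ = inj₁-≡-dec _≟ᵘ_
    cut (tensor d e) _≟_ (inj₁ (inj₂ k)) eq =
      ⊢-resp-≃ (≃-sym (remove-,,-∪-comm _≟_ _≟ᵘ_ (inj₂ k)
                        ⊚ ,,-cong (∪-cong (remove-∪ʳ _≟ᵘ_ _≟ʳ_ k) ≃-refl ⊚ ∪-assoc)))
        (tensor d (cut-beside e _≟ʳ_ k eq))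
      where
        _≟ᵘ_ = inj₁-≡-dec _≟_
        _≟ʳ_ = inj₂-≡-dec _≟ᵘ_
    cut (allR _ _) _ (inj₂ tt) ()
    cut (allR Γs ⊢Γs) _≟_ (inj₁ (t , i)) eq =
      ⊢-resp-≃ (≃-sym (remove-,,-∪-comm _≟_ _≟ᵘ_ (t , i)))
        (cut-allR Γs ⊢Γs _≟ᵘ_ t i (cut-beside (⊢Γs t) (fibre-≡-dec _≟ᵘ_ t) i eq))
      where _≟ᵘ_ = inj₁-≡-dec _≟_
    cut (exR _) _ (inj₂ tt) ()
    cut (exR d) _≟_ (inj₁ k) eq =
      ⊢-resp-≃ (≃-sym (remove-,,-∪-comm _≟_ _≟ᵍ_ k))
        (exR (⊢-resp-≃ (∪-cong (remove-inst _≟ⁱ_ _≟ᵍ_ k) ≃-refl ⊚ inst-∪-comm) (cut d _≟ⁱ_ (inj₁ k) eq)))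
      where
        _≟ᵍ_ = inj₁-≡-dec _≟_
        _≟ⁱ_ = ⊎-≡-dec _≟ᵍ_ _≟ᶜ_
    cut (reindex e d) _≟_ k eq =
      ⊢-resp-≃ (∪-cong (remove-resp-≃ e′ _≟′_ _≟_ k) ≃-refl)
        (cut d _≟′_ (from e′ k) (trans (fm-to (≃-sym e′) k) eq))
      where
        e′ = ≅⇒≃ e
        _≟′_ = ≃-≡-dec (≃-sym e′) _≟_

    cut-beside : ⊢ S ,, A → (_≟_ : DecIdx S) (k : Idx S) → fm S k ≡ lit P →
                 ⊢ (remove S _≟_ k ∪ Δ) ,, A
    cut-beside d _≟_ k eq =
      ⊢-resp-≃ (remove-,,-∪-comm _≟ᵃ_ _≟_ k) (cut d _≟ᵃ_ (inj₁ k) eq)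
      where _≟ᵃ_ = ⊎-≡-dec _≟_ ⊤._≟_

mainTheorem2 : (Γ Δ : Seq) (P : Literal) →
               Countable Γ → Countable Δ →
               (⊢ Γ ,, lit P) → (⊢ Δ ,, lit (comp P)) → ⊢ Γ ∪ Δ
mainTheorem2 Γ Δ P countableΓ _ ⊢Γ,P ⊢Δ,P̄ =
  ⊢-resp-≃ (∪-cong (remove-top _≟_) ≃-refl) (AtomicCut.cut Δ P ⊢Δ,P̄ ⊢Γ,P _≟_ (inj₂ tt) refl)
  where _≟_ = ⊎-≡-dec (countable⇒≡-dec Γ countableΓ) ⊤._≟_
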